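{- Let $G=(V,E)$ be an undirected graph with positive edge weights $c:E\to\mathbb{R}_{+}$, let $t\ge1$, and let $T_\ell\subseteq\cdots\subseteq T_1\subseteq V$ be nested terminal sets. Let $\mathrm{TOP}$ be the cost of the solution produced by the oracle top-down algorithm and $\mathrm{BOT}$ the cost of the solution produced by the oracle bottom-up algorithm (both described below), and let $\mathrm{OPT}$ be the cost of an optimal MLGS solution. Then $\min(\mathrm{TOP},\mathrm{BOT})\le\frac{\ell+2}{3}\,\mathrm{OPT}$.
   Context: For a weighted graph $G$, $d_G(u,v)$ denotes the length of a shortest $u$–$v$ path in $G$ with respect to $c$. Given $S\subseteq V$ and $t\ge1$, a subgraph $H$ of $G$ is a subsetwise $(S\times S)$-spanner of $G$ with stretch factor $t$ if $d_H(u,v)\le t\cdot d_G(u,v)$ for all $u,v\in S$; its cost is the sum of the weights of its edges. The multi-level graph spanner (MLGS) problem: given $G$, $c$, nested terminals $T_\ell\subseteq\cdots\subseteq T_1\subseteq V$ and $t\ge1$, find subgraphs $G_\ell\subseteq\cdots\subseteq G_1$ of $G$ such that each $G_i$ is a subsetwise $(T_i\times T_i)$-spanner of $G$ with stretch factor $t$, minimizing the cost $\sum_{i=1}^{\ell}\sum_{e\in E(G_i)}c_e$. Oracle top-down algorithm: $G_\ell$ is a minimum-cost subsetwise $(T_\ell\times T_\ell)$-spanner with stretch $t$, and for $i=\ell-1,\dots,1$, $G_i$ is the union of $G_{i+1}$ with a minimum-cost subsetwise $(T_i\times T_i)$-spanner with stretch $t$; $\mathrm{TOP}=\sum_i\sum_{e\in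 E(G_i)}c_e$. Oracle bottom-up algorithm: let $H$ be a minimum-cost subsetwise $(T_1\times T_1)$-spanner with stretch $t$; output $G_1=H$ and $G_\ell\subseteq\cdots\subseteq G_2\subseteq H$, either $G_i=H$ for all $i$ or obtained by pruning edges of $H$ so that each $G_i$ remains a subsetwise $(T_i\times T_i)$-spanner with stretch $t$; $\mathrm{BOT}=\sum_i\sum_{e\in E(G_i)}c_e$.
   Formalization: The edge weights $c$ and the stretch factor $t$ take rational values instead of real ones. -}

module Defs where

open import Data.Nat as ℕ using (ℕ; zero; suc)
open import Data.Fin as Fin using (Fin; zero; suc; inject₁; fromℕ)
open import Data.Fin.Subset using (Subset; _∈_; _⊆_; _∪_; ⊤)
open import Data.Vec using (Vec; []; _∷_)
open import Data.Bool using (Bool; true; false; if_then_else_)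
open import Data.Rational as ℚ using (ℚ; 0ℚ; 1ℚ; _+_; _*_; _≤_; _<_; _⊓_; _/_)
open import Data.Integer using (+_)
open import Data.Product using (Σ; ∃; _×_; _,_; proj₁; proj₂)
open import Data.Sum using (_⊎_)
open import Relation.Binary.PropositionalEquality using (_≡_; _≢_)

record Graph : Set where
  field
    n    : ℕ
    m    : ℕ
    ends : Fin m → Fin n × Fin n
    w    : Fin m → ℚ
open Graph public

IsSimplePositive : Graph → Set
IsSimplePositive G =
  (∀ e → proj₁ (ends G e) ≢ proj₂ (ends G e)) ×
  (∀ e e' → (ends G e ≡ ends G e' ⊎
             (proj₁ (ends G e) ≡ proj₂ (ends G e') × proj₂ (ends G e) ≡ proj₁ (ends G e')))
          → e ≡ e') ×
  (∀ e → 0ℚ < w G e)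

Step : (G : Graph) → Fin (m G) → Fin (n G) → Fin (n G) → Set
Step G e u v = (proj₁ (ends G e) ≡ u × proj₂ (ends G e) ≡ v)
             ⊎ (proj₂ (ends G e) ≡ u × proj₁ (ends G e) ≡ v)

data Walk (G : Graph) (H : Subset (m G)) : Fin (n G) → Fin (n G) → Set where
  nil  : ∀ {u} → Walk G H u u
  cons : ∀ {u x v} (e : Fin (m G)) → e ∈ H → Step G e u x → Walk G H x v → Walk G H u v

len : ∀ {G H u v} → Walk G H u v → ℚ
len nil = 0ℚ
len {G} (cons e _ _ p) = w G e + len p

-- H is a subsetwise (S×S)-spanner of G with stretch t:
-- d_H(u,v) ≤ t·d_G(u,v), i.e. every u–v walk P in G is matched by a u–v walk
-- Q in H with len Q ≤ t · len P (distances are attained by walks).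
IsSpanner : (G : Graph) → ℚ → Subset (n G) → Subset (m G) → Set
IsSpanner G t S H = ∀ u v → u ∈ S → v ∈ S → (P : Walk G ⊤ u v) →
  Σ (Walk G H u v) λ Q → len Q ≤ t * len P

costVec : ∀ {k} → (Fin k → ℚ) → Vec Bool k → ℚ
costVec w [] = 0ℚ
costVec w (b ∷ bs) = (if b then w zero else 0ℚ) + costVec (λ i → w (suc i)) bs

cost : (G : Graph) → Subset (m G) → ℚ
cost G H = costVec (w G) H

sumFin : ∀ {k} → (Fin k → ℚ) → ℚ
sumFin {zero} f = 0ℚ
sumFin {suc k} f = f zero + sumFin (λ i → f (suc i))

IsMinSpanner : (G : Graph) → ℚ → Subset (n G) → Subset (m G) → Set
IsMinSpanner G t S H = IsSpanner G t S H × (∀ H' → IsSpanner G t S H' → cost G H ≤ cost G H')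

-- Levels are indexed by Fin ℓ with ℓ = suc k; index i corresponds to level i+1.
Nested : ∀ {k} {A : Set} → (A → A → Set) → (Fin k → A) → Set
Nested _⊑_ X = ∀ i j → i Fin.≤ j → X j ⊑ X i

IsMLGS : (G : Graph) → (t : ℚ) → ∀ {ℓ} → (Fin ℓ → Subset (n G)) → (Fin ℓ → Subset (m G)) → Set
IsMLGS G t T Gs = Nested _⊆_ Gs × (∀ i → IsSpanner G t (T i) (Gs i))

mlCost : (G : Graph) → ∀ {ℓ} → (Fin ℓ → Subset (m G)) → ℚ
mlCost G Gs = sumFin (λ i → cost G (Gs i))

IsTopDownRun : (G : Graph) → (t : ℚ) → ∀ {k} → (Fin (suc k) → Subset (n G)) →
               (Hs Gs : Fin (suc k) → Subset (m G)) → Set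
IsTopDownRun G t {k} T Hs Gs =
  (∀ i → IsMinSpanner G t (T i) (Hs i)) ×
  (Gs (fromℕ k) ≡ Hs (fromℕ k)) ×
  (∀ (i : Fin k) → Gs (inject₁ i) ≡ Gs (suc i) ∪ Hs (inject₁ i))

-- A run of the oracle bottom-up algorithm: H min-cost (T_1×T_1)-spanner,
-- G_1 = H, and G_ℓ ⊆ ... ⊆ G_2 ⊆ H each a (T_i×T_i)-spanner (either all
-- equal to H or obtained by pruning H).
IsBottomUpRun : (G : Graph) → (t : ℚ) → ∀ {k} → (Fin (suc k) → Subset (n G)) →
                (H : Subset (m G)) → (Gs : Fin (suc k) → Subset (m G)) → Set
IsBottomUpRun G t T H Gs =
  IsMinSpanner G t (T zero) H ×
  (Gs zero ≡ H) ×
  IsMLGS G t T Gs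

{-# OPTIONS --safe #-}
module Submission where

-- Let aᵢ be the cost of a minimum (Tᵢ × Tᵢ)-spanner. Since the terminal sets are
-- nested, a₁ ≥ a₂ ≥ ⋯ ≥ a_ℓ, and OPT ≥ a₁ + ⋯ + a_ℓ because level i of any
-- feasible solution is a (Tᵢ × Tᵢ)-spanner. Level i of the top-down solution costs
-- at most aᵢ + ⋯ + a_ℓ, while every level of the bottom-up solution lies inside
-- one minimum (T₁ × T₁)-spanner, so BOT ≤ ℓ a₁. For a non-increasing sequence these
-- bounds combine to 2 TOP + BOT ≤ (ℓ + 2) OPT, and min(TOP, BOT) ≤ (2 TOP + BOT) / 3.

open import Defs
open import Data.Nat as ℕ using (ℕ; zero; suc; z≤n; s≤s)
open import Data.Fin using (Fin; zero; suc; inject₁; fromℕ)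
open import Data.Fin.Subset using (Subset; _⊆_; _∪_)
open import Data.Fin.Subset.Properties using (drop-∷-⊆)
open import Data.Vec using ([]; _∷_; here)
open import Data.Bool using (Bool; true; false; if_then_else_; _∨_)
open import Algebra.Bundles using (CommutativeMonoid)
open import Data.Integer as ℤ using (+_)
open import Data.Rational using (ℚ; 0ℚ; 1ℚ; _≤_; _*_; _⊓_; _/_; _-_; -_; toℚᵘ; NonNegative)
open import Data.Rational.Properties
open import Data.Rational.Unnormalised as ℚᵘ using (mkℚᵘ; *≡*)
import Data.Rational.Unnormalised.Properties as ℚᵘ
open import Data.Product using (_,_; proj₁; proj₂)
open import Function using (_∘_)
open import Relation.Binary.PropositionalEquality using (_≡_; refl; sym; cong; subst)
open import Relation.Nullary.Decidable using (dec⇒maybe)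
open import Tactic.RingSolver using (solve-∀)
open import Tactic.RingSolver.Core.AlmostCommutativeRing using (AlmostCommutativeRing; fromCommutativeRing)
import Data.Integer.Tactic.RingSolver as ℤ-Solver

-- ℚ addition is opened only inside this module: _+_ in theorem4 is ℕ addition.
module _ where
  open import Data.Rational using (_+_)

  ℚ-ring : AlmostCommutativeRing _ _
  ℚ-ring = fromCommutativeRing +-*-commutativeRing (λ x → dec⇒maybe (0ℚ ≟ x))

  toℚ : ℕ → ℚ
  toℚ n = + n / 1

  toℚ-nonNeg : ∀ n → NonNegative (toℚ n)
  toℚ-nonNeg n = normalize-nonNeg n 1

  toℚᵘ-toℚ : ∀ n → toℚᵘ (toℚ n) ℚᵘ.≃ mkℚᵘ (+ n) 0
  toℚᵘ-toℚ n = toℚᵘ-fromℚᵘ (mkℚᵘ (+ n) 0)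

  toℚ-+ : ∀ m n → toℚ (m ℕ.+ n) ≡ toℚ m + toℚ n
  toℚ-+ m n = toℚᵘ-injective (begin
    toℚᵘ (toℚ (m ℕ.+ n))              ≈⟨ toℚᵘ-toℚ (m ℕ.+ n) ⟩
    mkℚᵘ (+ (m ℕ.+ n)) 0              ≈⟨ *≡* (numerators (+ m) (+ n)) ⟩
    mkℚᵘ (+ m) 0 ℚᵘ.+ mkℚᵘ (+ n) 0    ≈⟨ ℚᵘ.+-cong (toℚᵘ-toℚ m) (toℚᵘ-toℚ n) ⟨
    toℚᵘ (toℚ m) ℚᵘ.+ toℚᵘ (toℚ n)    ≈⟨ toℚᵘ-homo-+ (toℚ m) (toℚ n) ⟨
    toℚᵘ (toℚ m + toℚ n)              ∎)
    where
    open ℚᵘ.≃-Reasoning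
    numerators : ∀ i j → (i ℤ.+ j) ℤ.* (ℤ.1ℤ ℤ.* ℤ.1ℤ) ≡ (i ℤ.* ℤ.1ℤ ℤ.+ j ℤ.* ℤ.1ℤ) ℤ.* ℤ.1ℤ
    numerators = ℤ-Solver.solve-∀

  toℚ-*-/ : ∀ d .{{_ : ℕ.NonZero d}} n → toℚ d * (+ n / d) ≡ toℚ n
  toℚ-*-/ d@(suc d-1) n = toℚᵘ-injective (begin
    toℚᵘ (toℚ d * (+ n / d))          ≈⟨ toℚᵘ-homo-* (toℚ d) (+ n / d) ⟩
    toℚᵘ (toℚ d) ℚᵘ.* toℚᵘ (+ n / d)  ≈⟨ ℚᵘ.*-cong (toℚᵘ-toℚ d) (toℚᵘ-fromℚᵘ (mkℚᵘ (+ n) d-1)) ⟩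
    mkℚᵘ (+ d) 0 ℚᵘ.* mkℚᵘ (+ n) d-1  ≈⟨ *≡* (cross-multiply (+ d) (+ n)) ⟩
    mkℚᵘ (+ n) 0                      ≈⟨ toℚᵘ-toℚ n ⟨
    toℚᵘ (toℚ n)                      ∎)
    where
    open ℚᵘ.≃-Reasoning
    cross-multiply : ∀ i j → (i ℤ.* j) ℤ.* ℤ.1ℤ ≡ j ℤ.* (ℤ.1ℤ ℤ.* i)
    cross-multiply = ℤ-Solver.solve-∀

  sumFin-mono : ∀ {k} {f h : Fin k → ℚ} → (∀ i → f i ≤ h i) → sumFin f ≤ sumFin h
  sumFin-mono {zero}  _   = ≤-refl
  sumFin-mono {suc k} f≤h = +-mono-≤ (f≤h zero) (sumFin-mono (f≤h ∘ suc))

  sumFin≤k*c : ∀ {k} {f : Fin k → ℚ} {c} → (∀ i → f i ≤ c) → sumFin f ≤ toℚ k * c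
  sumFin≤k*c {zero}          {c = c} _   = ≤-reflexive (sym (*-zeroˡ c))
  sumFin≤k*c {suc k} {f} {c}         f≤c = begin
    f zero + sumFin (f ∘ suc)  ≤⟨ +-mono-≤ (f≤c zero) (sumFin≤k*c (f≤c ∘ suc)) ⟩
    c + toℚ k * c              ≡⟨ cong (_+ toℚ k * c) (*-identityˡ c) ⟨
    1ℚ * c + toℚ k * c         ≡⟨ *-distribʳ-+ c 1ℚ (toℚ k) ⟨
    (1ℚ + toℚ k) * c           ≡⟨ cong (_* c) (toℚ-+ 1 k) ⟨
    toℚ (suc k) * c            ∎
    where open ≤-Reasoning

  costVec-mono : ∀ {k} {w : Fin k → ℚ} → (∀ i → 0ℚ ≤ w i) →
                 ∀ {p q} → p ⊆ q → costVec w p ≤ costVec w q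
  costVec-mono         _   {[]}        {[]}        _   = ≤-refl
  costVec-mono {w = w} w≥0 {true ∷ p}  {true ∷ q}  p⊆q =
    +-monoʳ-≤ (w zero) (costVec-mono (w≥0 ∘ suc) (drop-∷-⊆ p⊆q))
  costVec-mono         _   {true ∷ _}  {false ∷ _} p⊆q with () ← p⊆q here
  costVec-mono         w≥0 {false ∷ p} {true ∷ q}  p⊆q =
    +-mono-≤ (w≥0 zero) (costVec-mono (w≥0 ∘ suc) (drop-∷-⊆ p⊆q))
  costVec-mono         w≥0 {false ∷ p} {false ∷ q} p⊆q =
    +-monoʳ-≤ 0ℚ (costVec-mono (w≥0 ∘ suc) (drop-∷-⊆ p⊆q))

  costVec-∪ : ∀ {k} {w : Fin k → ℚ} → (∀ i → 0ℚ ≤ w i) →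
              ∀ p q → costVec w (p ∪ q) ≤ costVec w p + costVec w q
  costVec-∪         _   []      []      = ≤-refl
  costVec-∪ {w = w} w≥0 (b ∷ p) (c ∷ q) = begin
    entry (b ∨ c) + costVec (w ∘ suc) (p ∪ q)
      ≤⟨ +-mono-≤ (entry-∨ b c) (costVec-∪ (w≥0 ∘ suc) p q) ⟩
    (entry b + entry c) + (costVec (w ∘ suc) p + costVec (w ∘ suc) q)
      ≡⟨ +-interchange (entry b) (entry c) _ _ ⟩
    (entry b + costVec (w ∘ suc) p) + (entry c + costVec (w ∘ suc) q)
      ∎
    where
    open ≤-Reasoning
    open import Algebra.Properties.CommutativeSemigroup
      (CommutativeMonoid.commutativeSemigroup +-0-commutativeMonoid)
      using () renaming (interchange to +-interchange)
    entry : Bool → ℚ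
    entry b = if b then w zero else 0ℚ
    entry-∨ : ∀ b c → entry (b ∨ c) ≤ entry b + entry c
    entry-∨ true  true  =
      ≤-trans (≤-reflexive (sym (+-identityʳ (w zero)))) (+-monoʳ-≤ (w zero) (w≥0 zero))
    entry-∨ true  false = ≤-reflexive (sym (+-identityʳ (w zero)))
    entry-∨ false c     = ≤-reflexive (sym (+-identityˡ (entry c)))

  spanner-antimono : ∀ {G t S S' H} → S' ⊆ S → IsSpanner G t S H → IsSpanner G t S' H
  spanner-antimono S'⊆S spans u v u∈S' v∈S' = spans u v (S'⊆S u∈S') (S'⊆S v∈S')

  minSpanner-cost-mono : ∀ {G t S S' H H'} → S' ⊆ S →
    IsMinSpanner G t S' H' → IsMinSpanner G t S H → cost G H' ≤ cost G H
  minSpanner-cost-mono {G} {t} {S} S'⊆S (_ , minimal) (spans , _) =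
    minimal _ (spanner-antimono {G} {t} {S} S'⊆S spans)

  record BoundedBySuffixSums {k} (a g : Fin (suc k) → ℚ) : Set where
    constructor _,_
    field
      last : g (fromℕ k) ≤ a (fromℕ k)
      step : ∀ i → g (inject₁ i) ≤ g (suc i) + a (inject₁ i)

  BoundedBySuffixSums-tail : ∀ {k} {a g : Fin (suc (suc k)) → ℚ} →
    BoundedBySuffixSums a g → BoundedBySuffixSums (a ∘ suc) (g ∘ suc)
  BoundedBySuffixSums-tail (last , step) = last , step ∘ suc

  BoundedBySuffixSums⇒head≤sum : ∀ {k} {a g : Fin (suc k) → ℚ} →
    BoundedBySuffixSums a g → g zero ≤ sumFin a
  BoundedBySuffixSums⇒head≤sum {zero}  {a} (last , _) =
    ≤-trans last (≤-reflexive (sym (+-identityʳ (a zero))))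
  BoundedBySuffixSums⇒head≤sum {suc k} {a} {g} bounded@(_ , step) = begin
    g zero                     ≤⟨ step zero ⟩
    g (suc zero) + a zero      ≤⟨ +-monoˡ-≤ (a zero) tail-head≤tail-sum ⟩
    sumFin (a ∘ suc) + a zero  ≡⟨ +-comm (sumFin (a ∘ suc)) (a zero) ⟩
    sumFin a                   ∎
    where
    open ≤-Reasoning
    tail-head≤tail-sum : g (suc zero) ≤ sumFin (a ∘ suc)
    tail-head≤tail-sum = BoundedBySuffixSums⇒head≤sum (BoundedBySuffixSums-tail bounded)

  Nested-tail : ∀ {k} {A : Set} {_⊑_ : A → A → Set} {X : Fin (suc k) → A} →
    Nested _⊑_ X → Nested _⊑_ (X ∘ suc)
  Nested-tail nested i j i≤j = nested (suc i) (suc j) (s≤s i≤j)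

  -- The slack of the bound grows by 2 (a₀ + s - g₀) + (ℓ a₁ - s) ≥ 0 when a₀, g₀ are prepended.
  suffixSums-bound-step : ∀ {ℓ a₀ a₁ g₀ s h} → g₀ ≤ a₀ + s → s ≤ ℓ * a₁ →
    (h + h) + ℓ * a₁ ≤ (ℓ + toℚ 2) * s →
    ((g₀ + h) + (g₀ + h)) + (1ℚ + ℓ) * a₀ ≤ ((1ℚ + ℓ) + toℚ 2) * (a₀ + s)
  suffixSums-bound-step {ℓ} {a₀} {a₁} {g₀} {s} {h} g₀≤a₀+s s≤ℓa₁ tail-bound = begin
    ((g₀ + h) + (g₀ + h)) + (1ℚ + ℓ) * a₀
      ≡⟨ split-tail g₀ h ℓ a₀ a₁ ⟩
    ((h + h) + ℓ * a₁) + (((g₀ + g₀) + (1ℚ + ℓ) * a₀) - ℓ * a₁)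
      ≤⟨ +-mono-≤ tail-bound
           (+-monoˡ-≤ (- (ℓ * a₁)) (+-monoˡ-≤ ((1ℚ + ℓ) * a₀) (+-mono-≤ g₀≤a₀+s g₀≤a₀+s))) ⟩
    (ℓ + toℚ 2) * s + ((((a₀ + s) + (a₀ + s)) + (1ℚ + ℓ) * a₀) - ℓ * a₁)
      ≡⟨ regroup a₀ s ℓ a₁ ⟩
    (bound - ℓ * a₁) + s
      ≤⟨ +-monoʳ-≤ (bound - ℓ * a₁) s≤ℓa₁ ⟩
    (bound - ℓ * a₁) + ℓ * a₁
      ≡⟨ cancel bound (ℓ * a₁) ⟩
    bound
      ∎
    where
    open ≤-Reasoning
    bound = ((1ℚ + ℓ) + toℚ 2) * (a₀ + s)
    split-tail : ∀ g₀ h ℓ a₀ a₁ → ((g₀ + h) + (g₀ + h)) + (1ℚ + ℓ) * a₀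
               ≡ ((h + h) + ℓ * a₁) + (((g₀ + g₀) + (1ℚ + ℓ) * a₀) - ℓ * a₁)
    split-tail = solve-∀ ℚ-ring
    regroup : ∀ a₀ s ℓ a₁ → (ℓ + toℚ 2) * s + ((((a₀ + s) + (a₀ + s)) + (1ℚ + ℓ) * a₀) - ℓ * a₁)
            ≡ (((1ℚ + ℓ) + toℚ 2) * (a₀ + s) - ℓ * a₁) + s
    regroup = solve-∀ ℚ-ring
    cancel : ∀ x y → (x - y) + y ≡ x
    cancel = solve-∀ ℚ-ring

  suffixSums-bound : ∀ {k} {a g : Fin (suc k) → ℚ} → Nested _≤_ a → BoundedBySuffixSums a g →
    (sumFin g + sumFin g) + toℚ (suc k) * a zero ≤ (toℚ (suc k) + toℚ 2) * sumFin a
  suffixSums-bound {zero} {a} {g} _ (last , _) = begin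
    (g₀ + 0ℚ + (g₀ + 0ℚ)) + 1ℚ * a₀  ≤⟨ +-monoˡ-≤ (1ℚ * a₀) (+-mono-≤ g₀≤a₀ g₀≤a₀) ⟩
    (a₀ + 0ℚ + (a₀ + 0ℚ)) + 1ℚ * a₀  ≡⟨ three-times a₀ ⟩
    (1ℚ + toℚ 2) * (a₀ + 0ℚ)         ∎
    where
    open ≤-Reasoning
    a₀ = a zero
    g₀ = g zero
    g₀≤a₀ : g₀ + 0ℚ ≤ a₀ + 0ℚ
    g₀≤a₀ = +-monoˡ-≤ 0ℚ last
    three-times : ∀ x → (x + 0ℚ + (x + 0ℚ)) + 1ℚ * x ≡ (1ℚ + toℚ 2) * (x + 0ℚ)
    three-times = solve-∀ ℚ-ring
  suffixSums-bound {suc k} {a} {g} nested bounded =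
    subst (λ ℓ′ → ((g₀ + h) + (g₀ + h)) + ℓ′ * a₀ ≤ (ℓ′ + toℚ 2) * (a₀ + s))
          (sym (toℚ-+ 1 (suc k)))
          (suffixSums-bound-step {ℓ = ℓ} {a₁ = a₁} g₀≤a₀+s s≤ℓa₁ induction-hypothesis)
    where
    ℓ = toℚ (suc k)
    a₀ = a zero
    a₁ = a (suc zero)
    g₀ = g zero
    s = sumFin (a ∘ suc)
    h = sumFin (g ∘ suc)
    induction-hypothesis : (h + h) + ℓ * a₁ ≤ (ℓ + toℚ 2) * s
    induction-hypothesis =
      suffixSums-bound (Nested-tail {_⊑_ = _≤_} {X = a} nested) (BoundedBySuffixSums-tail bounded)
    g₀≤a₀+s : g₀ ≤ a₀ + s
    g₀≤a₀+s = BoundedBySuffixSums⇒head≤sum bounded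
    s≤ℓa₁ : s ≤ ℓ * a₁
    s≤ℓa₁ = sumFin≤k*c (λ i → nested (suc zero) (suc i) (s≤s z≤n))

  minSpannerCosts-nested : ∀ {G t k} {T : Fin k → Subset (n G)} {Hs : Fin k → Subset (m G)} →
    Nested _⊆_ T → (∀ i → IsMinSpanner G t (T i) (Hs i)) → Nested _≤_ (λ i → cost G (Hs i))
  minSpannerCosts-nested {G} {t} {T = T} T-nested minimal i j i≤j =
    minSpanner-cost-mono {G} {t} {T i} (T-nested i j i≤j) (minimal j) (minimal i)

  topDown-costs-bounded : ∀ {G t k} {T : Fin (suc k) → Subset (n G)}
    {Hs Gs : Fin (suc k) → Subset (m G)} → (∀ e → 0ℚ ≤ w G e) → IsTopDownRun G t T Hs Gs →
    BoundedBySuffixSums (λ i → cost G (Hs i)) (λ i → cost G (Gs i))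
  topDown-costs-bounded {G} {Hs = Hs} {Gs} w≥0 (_ , last , step) =
    ≤-reflexive (cong (cost G) last) ,
    λ i → ≤-trans (≤-reflexive (cong (cost G) (step i)))
                  (costVec-∪ w≥0 (Gs (suc i)) (Hs (inject₁ i)))

  bottomUp-cost-bound : ∀ {G t k} {T : Fin (suc k) → Subset (n G)} {H H' : Subset (m G)}
    {Gs : Fin (suc k) → Subset (m G)} →
    (∀ e → 0ℚ ≤ w G e) → IsBottomUpRun G t T H Gs → IsSpanner G t (T zero) H' →
    mlCost G Gs ≤ toℚ (suc k) * cost G H'
  bottomUp-cost-bound {H' = H'} w≥0 ((_ , minimal) , refl , nested , _) spans =
    sumFin≤k*c λ i → ≤-trans (costVec-mono w≥0 (nested zero i z≤n)) (minimal H' spans)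

  top+top+bot≤[ℓ+2]*opt : (G : Graph) → (∀ e → 0ℚ ≤ w G e) → (t : ℚ) →
    (k : ℕ) → (T : Fin (suc k) → Subset (n G)) → Nested _⊆_ T →
    (Hs Gtop : Fin (suc k) → Subset (m G)) → IsTopDownRun G t T Hs Gtop →
    (H : Subset (m G)) (Gbot : Fin (suc k) → Subset (m G)) → IsBottomUpRun G t T H Gbot →
    (Gopt : Fin (suc k) → Subset (m G)) → IsMLGS G t T Gopt →
    (mlCost G Gtop + mlCost G Gtop) + mlCost G Gbot ≤ toℚ (suc k ℕ.+ 2) * mlCost G Gopt
  top+top+bot≤[ℓ+2]*opt G w≥0 t k T T-nested Hs Gtop top H Gbot bot Gopt (_ , opt-spans) = begin
    (TOP + TOP) + mlCost G Gbot
      ≤⟨ +-monoʳ-≤ (TOP + TOP)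
           (bottomUp-cost-bound {t = t} {T = T} {H = H} {Gs = Gbot} w≥0 bot (proj₁ (minimal zero))) ⟩
    (TOP + TOP) + toℚ (suc k) * a zero
      ≤⟨ suffixSums-bound (minSpannerCosts-nested {t = t} {T = T} T-nested minimal)
                          (topDown-costs-bounded {t = t} {T = T} {Gs = Gtop} w≥0 top) ⟩
    (toℚ (suc k) + toℚ 2) * sumFin a
      ≡⟨ cong (_* sumFin a) (toℚ-+ (suc k) 2) ⟨
    toℚ (suc k ℕ.+ 2) * sumFin a
      ≤⟨ *-monoˡ-≤-nonNeg (toℚ (suc k ℕ.+ 2)) {{toℚ-nonNeg (suc k ℕ.+ 2)}}
           (sumFin-mono λ i → proj₂ (minimal i) (Gopt i) (opt-spans i)) ⟩
    toℚ (suc k ℕ.+ 2) * mlCost G Gopt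
      ∎
    where
    open ≤-Reasoning
    minimal = proj₁ top
    TOP = mlCost G Gtop
    a : Fin (suc k) → ℚ
    a i = cost G (Hs i)

  p+p+q≤n*r⇒p⊓q≤n/3*r : ∀ n p q r → (p + p) + q ≤ toℚ n * r → p ⊓ q ≤ (+ n / 3) * r
  p+p+q≤n*r⇒p⊓q≤n/3*r n p q r p+p+q≤n*r = *-cancelˡ-≤-pos (toℚ 3) (begin
    toℚ 3 * (p ⊓ q)              ≡⟨ triple (p ⊓ q) ⟩
    (p ⊓ q + p ⊓ q) + p ⊓ q      ≤⟨ +-mono-≤ (+-mono-≤ (p⊓q≤p p q) (p⊓q≤p p q)) (p⊓q≤q p q) ⟩
    (p + p) + q                  ≤⟨ p+p+q≤n*r ⟩
    toℚ n * r                    ≡⟨ cong (_* r) (toℚ-*-/ 3 n) ⟨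
    (toℚ 3 * (+ n / 3)) * r      ≡⟨ *-assoc (toℚ 3) (+ n / 3) r ⟩
    toℚ 3 * ((+ n / 3) * r)      ∎)
    where
    open ≤-Reasoning
    triple : ∀ x → toℚ 3 * x ≡ (x + x) + x
    triple = solve-∀ ℚ-ring

open import Data.Nat using (_+_)

theorem4 : (G : Graph) → IsSimplePositive G →
    (t : ℚ) → 1ℚ ≤ t →
    (k : ℕ) → (T : Fin (suc k) → Subset (n G)) → Nested _⊆_ T →
    (Hs Gtop : Fin (suc k) → Subset (m G)) → IsTopDownRun G t T Hs Gtop →
    (H : Subset (m G)) (Gbot : Fin (suc k) → Subset (m G)) → IsBottomUpRun G t T H Gbot →
    (Gopt : Fin (suc k) → Subset (m G)) → IsMLGS G t T Gopt →
    (mlCost G Gtop ⊓ mlCost G Gbot) ≤ ((+ (suc k + 2) / 3) * mlCost G Gopt)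
theorem4 G (_ , _ , w>0) t _ k T T-nested Hs Gtop top H Gbot bot Gopt opt =
  p+p+q≤n*r⇒p⊓q≤n/3*r (suc k + 2) (mlCost G Gtop) (mlCost G Gbot) (mlCost G Gopt)
    (top+top+bot≤[ℓ+2]*opt G (λ e → <⇒≤ (w>0 e)) t k T T-nested Hs Gtop top H Gbot bot Gopt opt)
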